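{- Let $(G,\prec)$ be a Nyldon-like set over $A$, let $m\ge 2$, and let $u_1,u_2,\dots,u_m$ be $G$-words such that (1) the word $w=u_1u_2\cdots u_m$ is in $G$; (2) for all $1\le i\le j\le m$, every $G$-factorization of $u_iu_{i+1}\cdots u_j$ preserves the blocks $u_i,u_{i+1},\dots,u_j$. Then $w\succ u_1$.
   Context: $A$ is a finite alphabet with at least two letters. For $w\in A^+$, a $G$-factorization of $w$ is a sequence $(w_1,\dots,w_k)$, $k\ge 1$, of words of $G$ with $w=w_1w_2\cdots w_k$ and $w_1\preceq w_2\preceq\cdots\preceq w_k$. A Nyldon-like set is a pair $(G,\prec)$ with $G\subseteq A^+$ and $\prec$ a total order on $G$ such that: every letter of $A$ lies in $G$; a word $w$ of length at least $2$ lies in $G$ if and only if $w$ has no $G$-factorization with $k\ge 2$ factors; and for all $f,g\in G$ with $fg\in G$ we have $f\prec fg$. Elements of $G$ are called $G$-words. If $w=u_1u_2\cdots u_k$ is viewed as a concatenation of blocks $u_1,\dots,u_k$ (at fixed positions), a factorization $(n_1,\dots,n_r)$ of $w$ preserves the blocks if each $n_i$ is a concatenation of consecutive blocks, i.e. no factor starts or ends strictly inside a block. -}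

module Defs where

open import Data.Nat using (ℕ; _≤_)
open import Data.Fin using (Fin)
open import Data.List using (List; []; _∷_; [_]; _++_; concat; map; length)
open import Data.List.Relation.Unary.All using (All)
open import Data.List.Relation.Unary.Linked using (Linked)
open import Data.Product using (Σ; ∃; _×_; _,_)
open import Data.Sum using (_⊎_)
open import Relation.Binary.PropositionalEquality using (_≡_; _≢_)
open import Relation.Nullary using (¬_)
open import Function.Bundles using (_⇔_)

Word : ℕ → Set
Word n = List (Fin n)

module _ {n : ℕ} (G : Word n → Set) (_≺_ : Word n → Word n → Set) where

  _⪯_ : Word n → Word n → Set
  x ⪯ y = x ≺ y ⊎ x ≡ y

  record IsGFactorization (w : Word n) (fs : List (Word n)) : Set where
    field
      nonempty : fs ≢ []
      inG      : All G fs
      product  : concat fs ≡ w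
      sorted   : Linked _⪯_ fs

  record NyldonLike : Set where
    field
      G-nonempty  : ∀ w → G w → w ≢ []
      ≺-irrefl    : ∀ x → G x → ¬ (x ≺ x)
      ≺-trans     : ∀ x y z → G x → G y → G z → x ≺ y → y ≺ z → x ≺ z
      ≺-trichot   : ∀ x y → G x → G y → x ≺ y ⊎ x ≡ y ⊎ y ≺ x
      letters     : ∀ a → G [ a ]
      characterise : ∀ w → 2 ≤ length w →
                     G w ⇔ (¬ (Σ (List (Word n)) λ fs → IsGFactorization w fs × 2 ≤ length fs))
      prefix      : ∀ f g → G f → G g → G (f ++ g) → f ≺ (f ++ g)

-- Viewing  concat us  as the blocks us, the factorization fs preserves the blocks
-- iff the blocks can be grouped into consecutive nonempty groups whose
-- concatenations are exactly the factors.
PreservesBlocks : ∀ {n} → List (Word n) → List (Word n) → Set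
PreservesBlocks {n} us fs =
  Σ (List (List (Word n))) λ gss →
    All (λ gs → gs ≢ []) gss × concat gss ≡ us × map concat gss ≡ fs

module Submission where

-- The hypothesis on factorizations makes the blocks u₁, …, u_m behave like letters: a
-- G-factorization of a run of consecutive blocks only cuts between blocks, so it is a sorted
-- sequence of G-segments, and a G-segment has no such factorization with two or more factors.
-- Classically every segment is in G or has such a proper factorization; only the double
-- negation of this is constructive, which suffices because x ≺ y is ¬¬-stable by trichotomy.
-- From it one shows, by induction on the number of blocks, that the last factor of a block
-- factorization is the longest suffix that is a G-segment. Hence a G-segment s of at least two
-- blocks splits as s = p t with t its longest proper G-suffix, p ∈ G and t ≺ p. The prefix
-- axiom gives p ≺ s, and induction on p gives u₁ ⪯ p, so u₁ ≺ s.

open import Defs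
open import Data.Nat using (ℕ; zero; suc; _≤_; _<_; _+_; _∸_; z≤n; s≤s; _<?_; _≤?_)
open import Data.Nat.Properties
open import Data.Nat.Induction using (<-wellFounded)
open import Induction.WellFounded using (Acc; acc)
open import Data.List using (List; []; _∷_; _++_; concat; map; length; take; drop)
open import Data.List.Properties
  using ( ++-identityʳ; ++-conicalˡ; ∷-injective; concat-++; take-[]; take-all; take++drop≡id
        ; drop-drop; length-drop)
open import Data.List.Relation.Unary.All using (All; []; _∷_)
open import Data.List.Relation.Unary.All.Properties using (drop⁺)
open import Data.List.Relation.Unary.Linked using (Linked; [-]; _∷_)
open import Data.Product using (∃; ∃₂; _×_; _,_; proj₁)
import Data.Product as Product
open import Data.Sum using (_⊎_; inj₁; inj₂)
import Data.Sum as Sum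
open import Data.Empty using (⊥; ⊥-elim)
open import Function.Base using (_∘_)
open import Function.Bundles using (Equivalence)
open import Relation.Nullary using (¬_; Dec; yes; no)
open import Relation.Nullary.Negation using (¬¬-map)
open import Relation.Binary.PropositionalEquality

take-+ : ∀ {A : Set} a b (xs : List A) → take (a + b) xs ≡ take a xs ++ take b (drop a xs)
take-+ zero    b xs       = refl
take-+ (suc a) b []       = sym (take-[] b)
take-+ (suc a) b (x ∷ xs) = cong (x ∷_) (take-+ a b xs)

++≡take⇒ : ∀ {A : Set} (xs ys : List A) t zs → xs ++ ys ≡ take t zs →
           xs ≡ take (length xs) zs × ys ≡ take (t ∸ length xs) (drop (length xs) zs)
++≡take⇒ []       ys t       zs       eq = refl , eq
++≡take⇒ (x ∷ xs) ys zero    zs       ()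
++≡take⇒ (x ∷ xs) ys (suc t) []       ()
++≡take⇒ (x ∷ xs) ys (suc t) (z ∷ zs) eq with ∷-injective eq
... | refl , eq′ = Product.map₁ (cong (x ∷_)) (++≡take⇒ xs ys t zs eq′)

2≤length-++ : ∀ {A : Set} (xs ys : List A) → xs ≢ [] → ys ≢ [] → 2 ≤ length (xs ++ ys)
2≤length-++ []          _       xs≢[] _     = ⊥-elim (xs≢[] refl)
2≤length-++ (_ ∷ _)     []      _     ys≢[] = ⊥-elim (ys≢[] refl)
2≤length-++ (_ ∷ [])    (_ ∷ _) _     _     = s≤s (s≤s z≤n)
2≤length-++ (_ ∷ _ ∷ _) (_ ∷ _) _     _     = s≤s (s≤s z≤n)

∸-telescope : ∀ {i j k} → i ≤ j → j ≤ k → (j ∸ i) + (k ∸ j) ≡ k ∸ i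
∸-telescope {i} {j} {k} i≤j j≤k = begin
  (j ∸ i) + (k ∸ j) ≡⟨ +-comm (j ∸ i) (k ∸ j) ⟩
  (k ∸ j) + (j ∸ i) ≡⟨ +-∸-assoc (k ∸ j) i≤j ⟨
  (k ∸ j) + j ∸ i   ≡⟨ cong (_∸ i) (m∸n+n≡m j≤k) ⟩
  k ∸ i             ∎
  where open ≡-Reasoning

∸-shrinks : ∀ {i j a b} → i < j → i < a → b ≤ j → b ∸ a < j ∸ i
∸-shrinks {i} i<j i<a b≤j = ≤-<-trans (∸-mono b≤j i<a) (∸-monoʳ-< (n<1+n i) i<j)

¬¬-∀< : ∀ {P : ℕ → Set} N → (∀ x → x < N → ¬ ¬ P x) → ¬ ¬ (∀ x → x < N → P x)
¬¬-∀< zero    _ k = k λ _ ()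
¬¬-∀< {P} (suc N) h k =
  ¬¬-∀< N (λ x x<N → h x (m<n⇒m<1+n x<N)) λ below → h N (n<1+n N) λ pN → k (extend below pN)
  where
  extend : (∀ x → x < N → P x) → P N → ∀ x → x < suc N → P x
  extend below pN x x<1+N with m<1+n⇒m<n∨m≡n x<1+N
  ... | inj₁ x<N = below x x<N
  ... | inj₂ refl = pN

LeastAbove : (ℕ → Set) → ℕ → ℕ → Set
LeastAbove P i z = i < z × P z × (∀ {v} → i < v → v < z → ¬ P v)

least-above-or-none : ∀ {P : ℕ → Set} {i} b → (∀ {v} → i < v → v ≤ b → Dec (P v)) →
                      ∃ (LeastAbove P i) ⊎ (∀ {v} → i < v → v ≤ b → ¬ P v)
least-above-or-none zero _ = inj₂ λ i<v v≤0 _ → n≮0 (<-≤-trans i<v v≤0)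
least-above-or-none {P} {i} (suc b) P? with least-above-or-none b (λ i<v v≤b → P? i<v (m≤n⇒m≤1+n v≤b))
... | inj₁ least = inj₁ least
... | inj₂ none with i <? suc b
...   | no i≮1+b = inj₂ λ i<v v≤1+b _ → i≮1+b (<-≤-trans i<v v≤1+b)
...   | yes i<1+b with P? i<1+b ≤-refl
...     | yes p  = inj₁ (suc b , i<1+b , p , λ i<v v<1+b → none i<v (≤-pred v<1+b))
...     | no ¬p = inj₂ none′
  where
  none′ : ∀ {v} → i < v → v ≤ suc b → ¬ P v
  none′ i<v v≤1+b with m≤n⇒m<n∨m≡n v≤1+b
  ... | inj₁ v<1+b = none i<v (≤-pred v<1+b)
  ... | inj₂ refl = ¬p

least-above : ∀ {P : ℕ → Set} {i} b → (∀ {v} → i < v → v ≤ b → Dec (P v)) → i < b → P b →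
              ∃ (LeastAbove P i)
least-above b P? i<b pb with least-above-or-none b P?
... | inj₁ least = least
... | inj₂ none = ⊥-elim (none i<b ≤-refl pb)

module _ {n : ℕ} {G : Word n → Set} {_≺_ : Word n → Word n → Set} (NL : NyldonLike G _≺_) where

  open NyldonLike NL

  _≼_ : Word n → Word n → Set
  _≼_ = _⪯_ G _≺_

  ≺-≺-trans : ∀ {x y z} → G x → G y → G z → x ≺ y → y ≺ z → x ≺ z
  ≺-≺-trans = ≺-trans _ _ _

  ≺-≼-trans : ∀ {x y z} → G x → G y → G z → x ≺ y → y ≼ z → x ≺ z
  ≺-≼-trans gx gy gz x≺y (inj₁ y≺z) = ≺-≺-trans gx gy gz x≺y y≺z
  ≺-≼-trans _  _  _  x≺y (inj₂ refl) = x≺y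

  ≼-or-≻ : ∀ {x y} → G x → G y → x ≼ y ⊎ y ≺ x
  ≼-or-≻ gx gy = Sum.assocˡ (≺-trichot _ _ gx gy)

  ≺-stable : ∀ {x y} → G x → G y → ¬ ¬ (x ≺ y) → x ≺ y
  ≺-stable {x} {y} gx gy ¬¬x≺y with ≺-trichot x y gx gy
  ... | inj₁ x≺y = x≺y
  ... | inj₂ (inj₁ refl) = ⊥-elim (¬¬x≺y (≺-irrefl x gx))
  ... | inj₂ (inj₂ y≺x) =
    ⊥-elim (¬¬x≺y λ x≺y → ≺-irrefl x gx (≺-≺-trans gx gy gx x≺y y≺x))

  non-G⇒2≤length : ∀ w → w ≢ [] → ¬ G w → 2 ≤ length w
  non-G⇒2≤length []          w≢[] _   = ⊥-elim (w≢[] refl)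
  non-G⇒2≤length (a ∷ [])    _    ¬gw = ⊥-elim (¬gw (letters a))
  non-G⇒2≤length (_ ∷ _ ∷ _) _    _   = s≤s (s≤s z≤n)

  factorization-nonempty : ∀ {w fs} → IsGFactorization G _≺_ w fs → w ≢ []
  factorization-nonempty {fs = []}    fact = λ _ → IsGFactorization.nonempty fact refl
  factorization-nonempty {fs = f ∷ _} fact w≡[] with IsGFactorization.inG fact
  ... | gf ∷ _ = G-nonempty f gf (++-conicalˡ f _ (trans (IsGFactorization.product fact) w≡[]))

  BlockCondition : List (Word n) → Set
  BlockCondition us = ∀ (pre seg suf : List (Word n)) → us ≡ pre ++ seg ++ suf → seg ≢ [] →
                      ∀ fs → IsGFactorization G _≺_ (concat seg) fs → PreservesBlocks seg fs

  module Blocks (us : List (Word n)) (us-inG : All G us) (preserves : BlockCondition us) where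

    m : ℕ
    m = length us

    blocks : ℕ → ℕ → List (Word n)
    blocks i j = take (j ∸ i) (drop i us)

    segment : ℕ → ℕ → Word n
    segment i j = concat (blocks i j)

    -- A record rather than G (segment i j), so that i and j can be inferred from a proof.
    record InG (i j : ℕ) : Set where
      constructor inG
      field G-segment : G (segment i j)

    open InG

    blocks-++ : ∀ {i j k} → i ≤ j → j ≤ k → blocks i j ++ blocks j k ≡ blocks i k
    blocks-++ {i} {j} {k} i≤j j≤k = begin
      take (j ∸ i) (drop i us) ++ take (k ∸ j) (drop j us)
        ≡⟨ cong (λ xs → take (j ∸ i) (drop i us) ++ take (k ∸ j) xs) rest ⟨
      take (j ∸ i) (drop i us) ++ take (k ∸ j) (drop (j ∸ i) (drop i us))
        ≡⟨ take-+ (j ∸ i) (k ∸ j) (drop i us) ⟨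
      take ((j ∸ i) + (k ∸ j)) (drop i us)
        ≡⟨ cong (λ d → take d (drop i us)) (∸-telescope i≤j j≤k) ⟩
      take (k ∸ i) (drop i us) ∎
      where
      open ≡-Reasoning
      rest : drop (j ∸ i) (drop i us) ≡ drop j us
      rest = trans (drop-drop i (j ∸ i) us) (cong (λ d → drop d us) (m+[n∸m]≡n i≤j))

    segment-++ : ∀ {i j k} → i ≤ j → j ≤ k → segment i j ++ segment j k ≡ segment i k
    segment-++ {i} {j} {k} i≤j j≤k =
      trans (concat-++ (blocks i j) (blocks j k)) (cong concat (blocks-++ i≤j j≤k))

    blocks-split : ∀ {i j} gs rest → gs ++ rest ≡ blocks i j →
                   gs ≡ blocks i (i + length gs) × rest ≡ blocks (i + length gs) j
    blocks-split {i} {j} gs rest eq with ++≡take⇒ gs rest (j ∸ i) (drop i us) eq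
    ... | gs≡ , rest≡ =
      trans gs≡ (cong (λ d → take d (drop i us)) (sym (m+n∸m≡n i (length gs)))) ,
      trans rest≡ (cong₂ take (∸-+-assoc j i (length gs)) (drop-drop i (length gs) us))

    inG⇒< : ∀ {i j} → InG i j → i < j
    inG⇒< {i} {j} (inG g) with i <? j
    ... | yes i<j = i<j
    ... | no i≮j =
      ⊥-elim (G-nonempty _ g (cong (λ d → concat (take d (drop i us))) (m≤n⇒m∸n≡0 (≮⇒≥ i≮j))))

    block-inG : ∀ {t} → suc t ≤ m → InG t (suc t)
    block-inG {t} t<m = inG
      (subst (λ d → G (concat (take d (drop t us)))) (sym (m+n∸n≡m 1 t))
        (head-inG (drop⁺ t us-inG) (subst (0 <_) (sym (length-drop t us)) (m<n⇒0<n∸m t<m))))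
      where
      head-inG : ∀ {xs} → All G xs → 0 < length xs → G (concat (take 1 xs))
      head-inG (g ∷ _) _ = subst G (sym (++-identityʳ _)) g

    last-block : ∀ {i e} → e ≤ m → suc i < e → ∃ λ t → i < t × InG t e
    last-block {e = suc t} e≤m (s≤s i<t) = t , i<t , block-inG e≤m

    segment-nonempty : ∀ {i j} → i < j → j ≤ m → segment i j ≢ []
    segment-nonempty {i} i<j j≤m eq =
      G-nonempty _ (G-segment (block-inG (≤-trans i<j j≤m)))
        (++-conicalˡ _ _ (trans (segment-++ (n≤1+n i) i<j) eq))

    segment-prefix≺ : ∀ {i z e} → InG i z → InG z e → InG i e → segment i z ≺ segment i e
    segment-prefix≺ {i} {z} {e} i-z@(inG gi) z-e@(inG gz) (inG g) =
      subst (segment i z ≺_) join (prefix _ _ gi gz (subst G (sym join) g))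
      where
      join : segment i z ++ segment z e ≡ segment i e
      join = segment-++ (<⇒≤ (inG⇒< i-z)) (<⇒≤ (inG⇒< z-e))

    infixr 5 _∷⟨_⟩_

    -- A sorted G-factorization of segment i j into segments, with first factor segment i e
    -- and last factor segment f j.
    data BlockFactorization : ℕ → ℕ → ℕ → ℕ → Set where
      [_]    : ∀ {i j} → InG i j → BlockFactorization i j i j
      _∷⟨_⟩_ : ∀ {i e e′ f j} → InG i e → segment i e ≼ segment e e′ →
               BlockFactorization e e′ f j → BlockFactorization i e f j

    first-inG : ∀ {i e f j} → BlockFactorization i e f j → InG i e
    first-inG [ g ]        = g
    first-inG (g ∷⟨ _ ⟩ _) = g

    last-inG : ∀ {i e f j} → BlockFactorization i e f j → InG f j
    last-inG [ g ]        = g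
    last-inG (_ ∷⟨ _ ⟩ p) = last-inG p

    start<end : ∀ {i e f j} → BlockFactorization i e f j → i < j
    start<end [ g ]        = inG⇒< g
    start<end (g ∷⟨ _ ⟩ p) = <-trans (inG⇒< g) (start<end p)

    first≤end : ∀ {i e f j} → BlockFactorization i e f j → e ≤ j
    first≤end [ _ ]        = ≤-refl
    first≤end (_ ∷⟨ _ ⟩ p) = <⇒≤ (start<end p)

    start≤last : ∀ {i e f j} → BlockFactorization i e f j → i ≤ f
    start≤last [ _ ]        = ≤-refl
    start≤last (g ∷⟨ _ ⟩ p) = ≤-trans (<⇒≤ (inG⇒< g)) (start≤last p)

    factors : ∀ {i e f j} → BlockFactorization i e f j → List (Word n)
    factors {i} {j = j} [ _ ]        = segment i j ∷ []
    factors {i} {e}     (_ ∷⟨ _ ⟩ p) = segment i e ∷ factors p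

    factors≢[] : ∀ {i e f j} (p : BlockFactorization i e f j) → factors p ≢ []
    factors≢[] [ _ ]        ()
    factors≢[] (_ ∷⟨ _ ⟩ _) ()

    factors-inG : ∀ {i e f j} (p : BlockFactorization i e f j) → All G (factors p)
    factors-inG [ g ]        = G-segment g ∷ []
    factors-inG (g ∷⟨ _ ⟩ p) = G-segment g ∷ factors-inG p

    factors-sorted : ∀ {i e f j} (p : BlockFactorization i e f j) → Linked _≼_ (factors p)
    factors-sorted [ _ ]                      = [-]
    factors-sorted (_ ∷⟨ o ⟩ [ _ ])            = o ∷ [-]
    factors-sorted (_ ∷⟨ o ⟩ p@(_ ∷⟨ _ ⟩ _)) = o ∷ factors-sorted p

    concat-factors : ∀ {i e f j} (p : BlockFactorization i e f j) → concat (factors p) ≡ segment i j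
    concat-factors [ _ ]        = ++-identityʳ _
    concat-factors (g ∷⟨ _ ⟩ p) =
      trans (cong (_ ++_) (concat-factors p)) (segment-++ (<⇒≤ (inG⇒< g)) (<⇒≤ (start<end p)))

    isGFactorization : ∀ {i e f j} (p : BlockFactorization i e f j) →
                       IsGFactorization G _≺_ (segment i j) (factors p)
    isGFactorization p = record
      { nonempty = factors≢[] p
      ; inG      = factors-inG p
      ; product  = concat-factors p
      ; sorted   = factors-sorted p
      }

    inG-atomic : ∀ {i e f j} → InG i j → BlockFactorization i e f j → e ≡ j × f ≡ i
    inG-atomic _ [ _ ] = refl , refl
    inG-atomic {i} {j = j} g p@(g₁ ∷⟨ _ ⟩ q) =
      ⊥-elim (Equivalence.to (characterise _ long) (G-segment g)
        (factors p , isGFactorization p , two-factors q))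
      where
      long : 2 ≤ length (segment i j)
      long = subst (λ w → 2 ≤ length w) (segment-++ (<⇒≤ (inG⇒< g₁)) (<⇒≤ (start<end q)))
               (2≤length-++ _ _ (G-nonempty _ (G-segment g₁))
                 (factorization-nonempty (isGFactorization q)))
      two-factors : ∀ {i e f j} (q : BlockFactorization i e f j) → 2 ≤ suc (length (factors q))
      two-factors [ _ ]        = s≤s (s≤s z≤n)
      two-factors (_ ∷⟨ _ ⟩ _) = s≤s (s≤s z≤n)

    append : ∀ {a e₁ f₁ b e₂ f₂ c} → BlockFactorization a e₁ f₁ b →
             segment f₁ b ≼ segment b e₂ → BlockFactorization b e₂ f₂ c →
             BlockFactorization a e₁ f₂ c
    append [ g ]         o q = g ∷⟨ o ⟩ q
    append (g ∷⟨ o′ ⟩ p) o q = g ∷⟨ o′ ⟩ append p o q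

    indecomposable : ∀ {a e₁ f₁ b e₂ f₂ c} → InG a c → BlockFactorization a e₁ f₁ b →
                     segment f₁ b ≼ segment b e₂ → BlockFactorization b e₂ f₂ c → ⊥
    indecomposable g p o q =
      <-irrefl (proj₁ (inG-atomic g (append p o q))) (≤-<-trans (first≤end p) (start<end q))

    unsnoc : ∀ {a e f b} → BlockFactorization a e f b → a < f →
             ∃ λ f′ → BlockFactorization a e f′ f × segment f′ f ≼ segment f b
    unsnoc [ _ ]                        a<a = ⊥-elim (<-irrefl refl a<a)
    unsnoc (g ∷⟨ o ⟩ [ _ ])             _   = _ , [ g ] , o
    unsnoc (g ∷⟨ o ⟩ p@(g′ ∷⟨ _ ⟩ q)) _   with unsnoc p (<-≤-trans (inG⇒< g′) (start≤last q))
    ... | f′ , p′ , o′ = f′ , g ∷⟨ o ⟩ p′ , o′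

    init-inG⇒≼last : ∀ {a e f b} → InG a f → BlockFactorization a e f b → a < f →
                     segment a f ≼ segment f b
    init-inG⇒≼last g p a<f with unsnoc p a<f
    ... | _ , q , o with inG-atomic g q
    ... | _ , refl = o

    grouping⇒blockFactorization :
      ∀ {i j} gs gss → concat (gs ∷ gss) ≡ blocks i j →
      All G (map concat (gs ∷ gss)) → Linked _≼_ (map concat (gs ∷ gss)) →
      ∃₂ λ e f → BlockFactorization i e f j × segment i e ≡ concat gs
    grouping⇒blockFactorization {i} {j} gs [] eq (g ∷ []) _ = _ , _ , [ inG (subst G (sym gs≡) g) ] , gs≡
      where
      gs≡ : segment i j ≡ concat gs
      gs≡ = cong concat (sym (trans (sym (++-identityʳ gs)) eq))
    grouping⇒blockFactorization {i} gs (gs′ ∷ gss) eq (g ∷ gss-inG) (o ∷ sorted)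
      with blocks-split {i} gs _ eq
    ... | gs≡ , rest≡ with grouping⇒blockFactorization {i + length gs} gs′ gss rest≡ gss-inG sorted
    ...   | e′ , _ , p , gs′≡ = i + length gs , _ , inG (subst G gs≡′ g) ∷⟨ o′ ⟩ p , sym gs≡′
      where
      gs≡′ : concat gs ≡ segment i (i + length gs)
      gs≡′ = cong concat gs≡
      o′ : segment i (i + length gs) ≼ segment (i + length gs) e′
      o′ = subst₂ _≼_ gs≡′ (sym gs′≡) o

    us-split : ∀ i j → us ≡ take i us ++ blocks i j ++ drop (j ∸ i) (drop i us)
    us-split i j =
      sym (trans (cong (take i us ++_) (take++drop≡id (j ∸ i) (drop i us))) (take++drop≡id i us))

    gFactorization⇒blockFactorization : ∀ {i j fs} → IsGFactorization G _≺_ (segment i j) fs →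
                                        ∃₂ λ e f → BlockFactorization i e f j
    gFactorization⇒blockFactorization {i} {j} {fs} fact
      with preserves (take i us) (blocks i j) (drop (j ∸ i) (drop i us)) (us-split i j)
             (factorization-nonempty fact ∘ cong concat) fs fact
    ... | [] , _ , _ , refl = ⊥-elim (IsGFactorization.nonempty fact refl)
    ... | gs ∷ gss , _ , eq , refl
      with grouping⇒blockFactorization gs gss eq (IsGFactorization.inG fact) (IsGFactorization.sorted fact)
    ...   | e , f , p , _ = e , f , p

    LongestProperSuffix : ℕ → ℕ → ℕ → Set
    LongestProperSuffix i z e = LeastAbove (λ v → InG v e) i z

    LastIsLongest : ℕ → ℕ → Set
    LastIsLongest i j = ∀ {e f} → BlockFactorization i e f j → ∀ {k} → i ≤ k → InG k j → f ≤ k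

    StandardFactorization : ℕ → ℕ → Set
    StandardFactorization i e =
      ∃ λ z → LongestProperSuffix i z e × InG i z × segment z e ≺ segment i z

    Splits : ℕ → ℕ → Set
    Splits i j = ∃₂ λ e f → e < j × BlockFactorization i e f j

    Dichotomy : Set
    Dichotomy = ∀ {i j} → i < j → j ≤ m → InG i j ⊎ Splits i j

    ¬¬dichotomy-at : ∀ {i j} → i < j → j ≤ m → ¬ ¬ (InG i j ⊎ Splits i j)
    ¬¬dichotomy-at {i} {j} i<j j≤m ¬dich = ¬inG (inG (Equivalence.from (characterise _ long) ¬split))
      where
      ¬inG : ¬ InG i j
      ¬inG = ¬dich ∘ inj₁
      long : 2 ≤ length (segment i j)
      long = non-G⇒2≤length _ (segment-nonempty i<j j≤m) (¬inG ∘ inG)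
      splits : ∃₂ (λ e f → BlockFactorization i e f j) → Splits i j
      splits (e , f , p) with m≤n⇒m<n∨m≡n (first≤end p)
      ... | inj₁ e<j = e , f , e<j , p
      ... | inj₂ refl = ⊥-elim (¬inG (first-inG p))
      ¬split : ¬ ∃ λ fs → IsGFactorization G _≺_ (segment i j) fs × 2 ≤ length fs
      ¬split (_ , fact , _) = ¬dich (inj₂ (splits (gFactorization⇒blockFactorization fact)))

    ¬¬dichotomy : ¬ ¬ Dichotomy
    ¬¬dichotomy = ¬¬-map reorder
      (¬¬-∀< (suc m) λ j j<1+m → ¬¬-∀< j λ i i<j → ¬¬dichotomy-at i<j (≤-pred j<1+m))
      where
      reorder : (∀ j → j < suc m → ∀ i → i < j → InG i j ⊎ Splits i j) → Dichotomy
      reorder h i<j j≤m = h _ (s≤s j≤m) _ i<j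

    module WithDichotomy (dichotomy : Dichotomy) where

      inG? : ∀ {i j} → i < j → j ≤ m → Dec (InG i j)
      inG? i<j j≤m with dichotomy i<j j≤m
      ... | inj₁ g = yes g
      ... | inj₂ (_ , _ , e<j , p) = no λ g → <-irrefl (proj₁ (inG-atomic g p)) e<j

      factorize : ∀ {i j} → i < j → j ≤ m → ∃₂ λ e f → BlockFactorization i e f j
      factorize i<j j≤m with dichotomy i<j j≤m
      ... | inj₁ g = _ , _ , [ g ]
      ... | inj₂ (e , f , _ , p) = e , f , p

      -- The last factor of a block factorization of segment a e starts at z: not before z by
      -- minimality of z, not after z because it is the longest G-suffix.
      ≼-longest-suffix : ∀ {i z e a} → e ≤ m → LongestProperSuffix i z e → LastIsLongest a e →
                         i < a → InG a z → segment a z ≼ segment z e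
      ≼-longest-suffix {i} {z} e≤m (i<z , z-e , below) longest i<a a-z
        with factorize (<-trans (inG⇒< a-z) (inG⇒< z-e)) e≤m
      ... | _ , f , p
        with ≤-antisym (longest p (<⇒≤ (inG⇒< a-z)) z-e)
                       (≮⇒≥ λ f<z → below (<-≤-trans i<a (start≤last p)) f<z (last-inG p))
      ... | refl = init-inG⇒≼last a-z p (inG⇒< a-z)

      standard-factorization : ∀ {i e} → InG i e → suc i < e → e ≤ m →
                               (∀ {a b} → i < a → b ≤ e → LastIsLongest a b) →
                               StandardFactorization i e
      standard-factorization {i} {e} i-e 1+i<e e≤m longer with last-block e≤m 1+i<e
      ... | t , i<t , t-e with least-above t (λ _ v≤t → inG? (≤-<-trans v≤t (inG⇒< t-e)) e≤m) i<t t-e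
      ... | z , least@(i<z , z-e , _) = z , least , i-z , z≺i
        where
        i-z : InG i z
        i-z with factorize i<z (≤-trans (<⇒≤ (inG⇒< z-e)) e≤m)
        ... | _ , f , p with m≤n⇒m<n∨m≡n (start≤last p)
        ...   | inj₂ refl = last-inG p
        ...   | inj₁ i<f = ⊥-elim (indecomposable i-e p last≼z [ z-e ])
          where
          last≼z : segment f z ≼ segment z e
          last≼z = ≼-longest-suffix e≤m least (longer i<f ≤-refl) i<f (last-inG p)
        z≺i : segment z e ≺ segment i z
        z≺i with ≼-or-≻ (G-segment i-z) (G-segment z-e)
        ... | inj₁ i≼z = ⊥-elim (indecomposable i-e [ i-z ] i≼z [ z-e ])
        ... | inj₂ z≺i = z≺i

      -- Let z start the longest proper G-suffix of the first factor. Replacing the first factor by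
      -- that suffix gives a block factorization of segment z j, which settles the case z ≤ k by
      -- induction; if k < z, a factorization of segment k z followed by it would split segment k j.
      last-is-longest-inside-first :
        ∀ {i e e′ f j k} → j ≤ m → (∀ {a b} → i < a → b ≤ j → LastIsLongest a b) →
        InG i e → segment i e ≼ segment e e′ → BlockFactorization e e′ f j →
        i < k → k < e → InG k j → f ≤ k
      last-is-longest-inside-first {i} {e} {e′} {f} {j} {k} j≤m longer i-e o rest i<k k<e k-j =
        f≤k (standard-factorization i-e (≤-<-trans i<k k<e) e≤m
              (λ i<a b≤e → longer i<a (≤-trans b≤e e≤j)))
        where
        e≤j : e ≤ j
        e≤j = <⇒≤ (start<end rest)
        e≤m : e ≤ m
        e≤m = ≤-trans e≤j j≤m
        suffix-then-rest : ∀ {z} → InG z e → InG i z → segment z e ≺ segment i z →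
                           BlockFactorization z e f j
        suffix-then-rest {z} z-e i-z z≺i = z-e ∷⟨ inj₁ z≺next ⟩ rest
          where
          z≺i-e : segment z e ≺ segment i e
          z≺i-e = ≺-≺-trans (G-segment z-e) (G-segment i-z) (G-segment i-e)
                    z≺i (segment-prefix≺ i-z z-e i-e)
          z≺next : segment z e ≺ segment e e′
          z≺next = ≺-≼-trans (G-segment z-e) (G-segment i-e) (G-segment (first-inG rest)) z≺i-e o
        f≤k : StandardFactorization i e → f ≤ k
        f≤k (z , least@(i<z , z-e , _) , i-z , z≺i) with z ≤? k
        ... | yes z≤k = longer i<z ≤-refl (suffix-then-rest z-e i-z z≺i) z≤k k-j
        ... | no z≰k with factorize (≰⇒> z≰k) (≤-trans (<⇒≤ (inG⇒< z-e)) e≤m)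
        ...   | _ , f′ , q = ⊥-elim (indecomposable k-j q last≼z (suffix-then-rest z-e i-z z≺i))
          where
          i<f′ : i < f′
          i<f′ = <-≤-trans i<k (start≤last q)
          last≼z : segment f′ z ≼ segment z e
          last≼z = ≼-longest-suffix e≤m least (longer i<f′ e≤j) i<f′ (last-inG q)

      last-is-longest-step : ∀ {i j} → j ≤ m → (∀ {a b} → i < a → b ≤ j → LastIsLongest a b) →
                             LastIsLongest i j
      last-is-longest-step _ _ [ _ ] i≤k _ = i≤k
      last-is-longest-step j≤m longer (_∷⟨_⟩_ {e = e} i-e o rest) {k} i≤k k-j with e ≤? k
      ... | yes e≤k = longer (inG⇒< i-e) ≤-refl rest e≤k k-j
      ... | no e≰k with m≤n⇒m<n∨m≡n i≤k
      ...   | inj₂ refl = ⊥-elim (indecomposable k-j [ i-e ] o rest)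
      ...   | inj₁ i<k = last-is-longest-inside-first j≤m longer i-e o rest i<k (≰⇒> e≰k) k-j

      last-is-longest : ∀ {i j} → j ≤ m → LastIsLongest i j
      last-is-longest = go (<-wellFounded _)
        where
        go : ∀ {i j} → Acc _<_ (j ∸ i) → j ≤ m → LastIsLongest i j
        go {i} {j} (acc rs) j≤m p = last-is-longest-step j≤m inner p
          where
          inner : ∀ {a b} → i < a → b ≤ j → LastIsLongest a b
          inner i<a b≤j = go (rs (∸-shrinks (start<end p) i<a b≤j)) (≤-trans b≤j j≤m)

      first-block≺ : ∀ {i e} → InG i e → suc i < e → e ≤ m → segment i (suc i) ≺ segment i e
      first-block≺ = go (<-wellFounded _)
        where
        go : ∀ {i e} → Acc _<_ e → InG i e → suc i < e → e ≤ m → segment i (suc i) ≺ segment i e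
        go (acc rs) i-e 1+i<e e≤m
          with standard-factorization i-e 1+i<e e≤m (λ _ b≤e → last-is-longest (≤-trans b≤e e≤m))
        ... | z , (i<z , z-e , _) , i-z , _ with m≤n⇒m<n∨m≡n i<z
        ...   | inj₂ refl = segment-prefix≺ i-z z-e i-e
        ...   | inj₁ 1+i<z =
          ≺-≺-trans (G-segment (block-inG (≤-trans (<⇒≤ 1+i<z) z≤m))) (G-segment i-z) (G-segment i-e)
            (go (rs (inG⇒< z-e)) i-z 1+i<z z≤m) (segment-prefix≺ i-z z-e i-e)
          where
          z≤m : z ≤ m
          z≤m = ≤-trans (<⇒≤ (inG⇒< z-e)) e≤m

    first-block≺whole : 2 ≤ m → InG 0 m → ¬ ¬ (segment 0 1 ≺ segment 0 m)
    first-block≺whole 2≤m whole-inG =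
      ¬¬-map first-block≺whole-from ¬¬dichotomy
      where
      first-block≺whole-from : Dichotomy → segment 0 1 ≺ segment 0 m
      first-block≺whole-from dichotomy = WithDichotomy.first-block≺ dichotomy whole-inG 2≤m ≤-refl

lemma3p3 : (n : ℕ) → 2 ≤ n →
    (G : Word n → Set) (_≺_ : Word n → Word n → Set) → NyldonLike G _≺_ →
    (u₁ : Word n) (rest : List (Word n)) → rest ≢ [] →
    All G (u₁ ∷ rest) →
    G (concat (u₁ ∷ rest)) →
    (∀ (pre seg suf : List (Word n)) → u₁ ∷ rest ≡ pre ++ seg ++ suf → seg ≢ [] →
       ∀ fs → IsGFactorization G _≺_ (concat seg) fs → PreservesBlocks seg fs) →
    u₁ ≺ concat (u₁ ∷ rest)
lemma3p3 _ _ _ _ _ _ [] rest≢[] _ _ _ = ⊥-elim (rest≢[] refl)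
lemma3p3 _ _ G _≺_ NL u₁ rest@(_ ∷ _) _ us-inG@(u₁-inG ∷ _) w-inG preserves =
  ≺-stable NL u₁-inG w-inG
    (subst₂ (λ x y → ¬ ¬ (x ≺ y)) (++-identityʳ u₁) whole
      (first-block≺whole (s≤s (s≤s z≤n)) (inG (subst G (sym whole) w-inG))))
  where
  open Blocks NL (u₁ ∷ rest) us-inG preserves
  whole : segment 0 m ≡ concat (u₁ ∷ rest)
  whole = cong concat (take-all m (u₁ ∷ rest) ≤-refl)
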